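{- For every integer $m\ge 1$ there exist non-isomorphic trees $T_1$ and $T_2$ such that $N_D(T_1)=N_D(T_2)$ for every vertex-labeled tree $D$ with at most $m$ vertices.
   Context: All graphs are finite and simple. Let $D$ be a tree whose vertices $u$ are labeled with positive integers $a_u$, and $T$ a tree. A degree embedding of $D$ into $T$ is a graph isomorphism $\varphi\colon D\to T'$ onto a subtree $T'$ of $T$ such that $a_u=\deg_T(\varphi(u))$ for all $u\in V(D)$. The degree embedding number $N_D(T)$ is the number of subtrees $T'\subseteq T$ that are the image of some degree embedding of $D$. -}

module Defs where

open import Data.Nat using (ℕ; zero; suc; _+_; _≤_)
open import Data.Fin using (Fin; zero; suc; inject₁; fromℕ)
open import Data.Bool using (Bool; true; false; if_then_else_)
open import Data.List using (List; map; allFin)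
open import Data.Nat.ListAction using (sum)
open import Data.Vec using (Vec; lookup)
open import Data.Fin.Subset using (Subset; _∈_)
open import Data.Product using (Σ; ∃; _×_; _,_)
open import Data.Unit using (⊤)
open import Data.Empty using (⊥)
open import Relation.Nullary using (¬_)
open import Relation.Binary.PropositionalEquality using (_≡_)
open import Function.Definitions using (Injective)
open import Function.Bundles using (_↔_; Inverse; _⇔_)

record Graph (n : ℕ) : Set where
  field
    adj    : Fin n → Fin n → Bool
    sym    : ∀ u v → adj u v ≡ adj v u
    irrefl : ∀ v → adj v v ≡ false
open Graph public

Adj : ∀ {n} → Graph n → Fin n → Fin n → Set
Adj G u v = adj G u v ≡ true

deg : ∀ {n} → Graph n → Fin n → ℕ
deg {n} G v = sum (map (λ w → if adj G v w then 1 else 0) (allFin n))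

data Walk {n : ℕ} (E : Fin n → Fin n → Set) : Fin n → Fin n → Set where
  here : ∀ {u} → Walk E u u
  step : ∀ {u w v} → E u w → Walk E w v → Walk E u v

Connected : ∀ {n} → (Fin n → Set) → (Fin n → Fin n → Set) → Set
Connected V E = ∀ u v → V u → V v → Walk E u v

record Cycle {n : ℕ} (E : Fin n → Fin n → Set) : Set where
  field
    len   : ℕ
    c     : Fin (suc (suc (suc len))) → Fin n
    inj   : Injective _≡_ _≡_ c
    edges : ∀ (i : Fin (suc (suc len))) → E (c (inject₁ i)) (c (suc i))
    close : E (c (fromℕ (suc (suc len)))) (c zero)

Acyclic : ∀ {n} → (Fin n → Fin n → Set) → Set
Acyclic E = ¬ Cycle E

IsTreeOn : ∀ {n} → (Fin n → Set) → (Fin n → Fin n → Set) → Set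
IsTreeOn V E = (∃ λ v → V v) × Connected V E × Acyclic E

IsTree : ∀ {n} → Graph n → Set
IsTree G = IsTreeOn (λ _ → ⊤) (Adj G)

Iso : ∀ {n₁ n₂} → Graph n₁ → Graph n₂ → Set
Iso {n₁} {n₂} G H =
  Σ (Fin n₁ ↔ Fin n₂) λ f → ∀ u v → adj H (Inverse.to f u) (Inverse.to f v) ≡ adj G u v

-- Subgraphs of a graph on Fin n: a vertex set and an edge set
-- (edge set as an adjacency matrix of subsets).

record Sub (n : ℕ) : Set where
  constructor sub
  field
    vs : Subset n
    es : Vec (Subset n) n
open Sub public

SEdge : ∀ {n} → Sub n → Fin n → Fin n → Set
SEdge S u v = v ∈ lookup (es S) u

SVert : ∀ {n} → Sub n → Fin n → Set
SVert S v = v ∈ vs S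

IsSubgraph : ∀ {n} → Graph n → Sub n → Set
IsSubgraph T S =
  (∀ u v → SEdge S u v → SEdge S v u) ×
  (∀ u v → SEdge S u v → Adj T u v) ×
  (∀ u v → SEdge S u v → SVert S u × SVert S v)

IsSubtree : ∀ {n} → Graph n → Sub n → Set
IsSubtree T S = IsSubgraph T S × IsTreeOn (SVert S) (SEdge S)

IsDegreeEmbeddingOnto : ∀ {k n} → (D : Graph k) → (a : Fin k → ℕ) →
  (T : Graph n) → Sub n → (Fin k → Fin n) → Set
IsDegreeEmbeddingOnto {k} D a T S φ =
  Injective _≡_ _≡_ φ ×
  (∀ v → SVert S v ⇔ (∃ λ u → φ u ≡ v)) ×
  (∀ u u' → SEdge S (φ u) (φ u') ⇔ Adj D u u') ×
  (∀ u → a u ≡ deg T (φ u))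

IsDegreeImage : ∀ {k n} → Graph k → (Fin k → ℕ) → Graph n → Sub n → Set
IsDegreeImage D a T S =
  IsSubtree T S × (∃ λ φ → IsDegreeEmbeddingOnto D a T S φ)

-- N_D(T₁) = N_D(T₂): the finite sets of such subtrees of T₁ and of T₂
-- are in bijection.
SameDegreeEmbeddingNumber : ∀ {k n₁ n₂} → Graph k → (Fin k → ℕ) →
  Graph n₁ → Graph n₂ → Set
SameDegreeEmbeddingNumber {k} {n₁} {n₂} D a T₁ T₂ =
  Σ (Sub n₁ → Sub n₂) λ f → Σ (Sub n₂ → Sub n₁) λ g →
    (∀ S → IsDegreeImage D a T₁ S → IsDegreeImage D a T₂ (f S) × g (f S) ≡ S) ×
    (∀ S → IsDegreeImage D a T₂ S → IsDegreeImage D a T₁ (g S) × f (g S) ≡ S)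

-- T₁ and T₂ are the path 0 — 1 — ⋯ — L, L = 4m + 4, with one more leaf X = L + 1 attached at c₁ = m + 1,
-- resp. at c₂ = 3m + 2. The involution swap of the path exchanging the blocks [1, 2m + 1] and [2m + 2, 4m + 2]
-- maps c₁ to c₂ and is a translation on the window of radius m around each of them. A subtree with at most
-- m vertices either avoids c₁, c₂ and X, and then all its vertices have the same neighbourhoods in T₁ and T₂,
-- or it lies in such a window (plus possibly X), and swap carries it together with the degrees of its
-- vertices to a subtree of the other tree. This matches the degree images in T₁ and T₂ bijectively. The
-- trees are not isomorphic: the leaf L of T₁ is joined to the vertex of degree 3 by a path of length 3m + 3
-- through vertices of degree 2, while every leaf of T₂ is closer to its vertex of degree 3.

module Submission where

open import Defs hiding (sym)
open import Data.Nat
open import Data.Nat.Properties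
open import Data.Fin using (Fin; zero; suc; toℕ; fromℕ; fromℕ<; inject₁)
open import Data.Fin.Properties
  using (toℕ<n; toℕ-fromℕ<; fromℕ<-toℕ; toℕ-injective; toℕ-inject₁; pigeonhole; toℕ≤pred[n])
open import Data.Fin.Subset using (Subset; _∈_)
open import Data.Fin.Permutation using (Permutation; permutation)
open import Data.Bool using (Bool; true; false; if_then_else_; _∨_)
open import Data.Bool.Properties using (∨-commutativeMonoid; ∨-conicalˡ; ∨-conicalʳ)
open import Algebra.Bundles using (CommutativeMonoid)
open import Algebra.Properties.CommutativeSemigroup (CommutativeMonoid.commutativeSemigroup ∨-commutativeMonoid)
  using (x∙yz≈y∙xz)
open import Data.List using (map; allFin)
import Data.List as List
import Data.List.Properties as List
open import Data.Nat.ListAction using (sum)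
open import Data.Vec using (lookup; tabulate)
open import Data.Vec.Properties using ([]=⇒lookup; lookup⇒[]=; lookup∘tabulate; tabulate∘lookup; tabulate-cong)
open import Data.Product using (Σ; ∃; ∃₂; _×_; _,_; proj₁; proj₂)
open import Data.Sum using (_⊎_; inj₁; inj₂)
import Data.Sum as Sum
open import Data.Empty using (⊥)
open import Data.Unit using (tt)
open import Function using (_∘_; id)
open import Function.Bundles using (_⇔_; mk⇔; Equivalence; Inverse)
open import Function.Definitions using (Injective)
open import Relation.Nullary using (¬_; Dec; yes; no; does; proof; contradiction)
open import Relation.Nullary.Decidable using (_×-dec_; _⊎-dec_; map′; does-⇔; dec-true; dec-false)
open import Relation.Nullary.Reflects using (Reflects; invert)
open import Relation.Binary.PropositionalEquality hiding ([_])
import Algebra.Properties.CommutativeMonoid.Sum as MonoidSum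

-- Walks, cycles and acyclicity

module _ {n} {E : Fin n → Fin n → Set} where

  _++ʷ_ : ∀ {u v w} → Walk E u v → Walk E v w → Walk E u w
  here     ++ʷ q = q
  step e p ++ʷ q = step e (p ++ʷ q)

  reverseʷ : (∀ {u v} → E u v → E v u) → ∀ {u v} → Walk E u v → Walk E v u
  reverseʷ E-sym here       = here
  reverseʷ E-sym (step e p) = reverseʷ E-sym p ++ʷ step (E-sym e) here

  mapʷ : ∀ {E′ : Fin n → Fin n → Set} (f : Fin n → Fin n) →
         (∀ {u v} → E u v → E′ (f u) (f v)) → ∀ {u v} → Walk E u v → Walk E′ (f u) (f v)
  mapʷ f f-edge here       = here
  mapʷ f f-edge (step e p) = step (f-edge e) (mapʷ f f-edge p)

last-or-inject₁ : ∀ {n} (i : Fin (suc n)) → i ≡ fromℕ n ⊎ ∃ λ j → i ≡ inject₁ j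
last-or-inject₁ {zero}  zero    = inj₁ refl
last-or-inject₁ {suc n} zero    = inj₂ (zero , refl)
last-or-inject₁ {suc n} (suc i) with last-or-inject₁ i
... | inj₁ i≡last   = inj₁ (cong suc i≡last)
... | inj₂ (j , eq) = inj₂ (suc j , cong suc eq)

argmax : ∀ {n} (g : Fin (suc n) → ℕ) → ∃ λ i → ∀ j → g j ≤ g i
argmax {zero}  g = zero , λ { zero → ≤-refl }
argmax {suc n} g with i , max ← argmax (g ∘ suc) with ≤-total (g zero) (g (suc i))
... | inj₁ g₀≤ = suc i , λ { zero → g₀≤ ; (suc j) → max j }
... | inj₂ ≤g₀ = zero  , λ { zero → ≤-refl ; (suc j) → ≤-trans (max j) ≤g₀ }

Linked : ∀ {n} → (Fin n → Fin n → Set) → Fin n → Fin n → Set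
Linked E u v = E u v ⊎ E v u

module _ {n} {E : Fin n → Fin n → Set} (C : Cycle E) where
  open Cycle C

  cycle-neighbours : ∀ i → ∃₂ λ a b → a ≢ b × Linked E (c i) (c a) × Linked E (c i) (c b)
  cycle-neighbours zero = suc zero , fromℕ _ , (λ ()) , inj₁ (edges zero) , inj₂ close
  cycle-neighbours (suc i) with last-or-inject₁ i
  ... | inj₁ refl = inject₁ (fromℕ _) , zero , (λ ()) , inj₂ (edges (fromℕ _)) , inj₁ close
  ... | inj₂ (j , refl) =
    inject₁ (inject₁ j) , suc (suc j) , apart , inj₂ (edges (inject₁ j)) , inj₁ (edges (suc j))
    where
    apart : inject₁ (inject₁ j) ≢ suc (suc j)
    apart eq = <⇒≢ (m<n+m (toℕ j) {2} z<s)
      (trans (sym (trans (toℕ-inject₁ (inject₁ j)) (toℕ-inject₁ j))) (cong toℕ eq))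

height⇒acyclic : ∀ {n} {E : Fin n → Fin n → Set} (h : Fin n → ℕ) →
  (∀ {u v} → E u v → h u ≢ h v) →
  (∀ {u v w} → Linked E u v → h v < h u → Linked E u w → h w < h u → v ≡ w) →
  Acyclic E
height⇒acyclic {E = E} h proper lower C
  with i , maximal ← argmax (h ∘ Cycle.c C)
  with a , b , a≢b , i~a , i~b ← cycle-neighbours C i
  = a≢b (Cycle.inj C (lower i~a (below i~a) i~b (below i~b)))
  where
  open Cycle C
  below : ∀ {a} → Linked E (c i) (c a) → h (c a) < h (c i)
  below {a} i~a = ≤∧≢⇒< (maximal a) (apart i~a)
    where
    apart : Linked E (c i) (c a) → h (c a) ≢ h (c i)
    apart (inj₁ e) eq = proper e (sym eq)
    apart (inj₂ e) eq = proper e eq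

-- Small connected sets have small spread

module _ {n} (V : Fin n → Set) (pos : Fin n → ℕ) where

  levels-exceed-cover : ∀ {k} (φ : Fin k → Fin n) → (∀ v → V v → ∃ λ u → φ u ≡ v) →
                        ∀ a → ¬ (∀ (t : Fin (suc k)) → ∃ λ w → V w × pos w ≡ a + toℕ t)
  levels-exceed-cover φ covers a level
    with i , j , i<j , same ← pigeonhole ≤-refl (λ t → proj₁ (covers _ (proj₁ (proj₂ (level t)))))
    = <⇒≢ i<j (+-cancelˡ-≡ a _ _ (begin
        a + toℕ i             ≡⟨ proj₂ (proj₂ (level i)) ⟨
        pos (proj₁ (level i)) ≡⟨ cong pos (trans (sym (proj₂ (covers _ _)))
                                                  (trans (cong φ same) (proj₂ (covers _ _)))) ⟩
        pos (proj₁ (level j)) ≡⟨ proj₂ (proj₂ (level j)) ⟩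
        a + toℕ j             ∎))
    where open ≡-Reasoning

module _ {n} (V : Fin n → Set) (E : Fin n → Fin n → Set) (pos : Fin n → ℕ)
  (E-closed : ∀ {u v} → E u v → V v) (pos-step : ∀ {u v} → E u v → pos v ≤ suc (pos u)) where

  walk-crosses : ∀ {y z} → Walk E y z → V y → ∀ t → pos y ≤ t → t ≤ pos z → ∃ λ w → V w × pos w ≡ t
  walk-crosses here Vy t y≤t t≤z = _ , Vy , ≤-antisym y≤t t≤z
  walk-crosses {y} (step e p) Vy t y≤t t≤z with pos y ≟ t
  ... | yes y≡t = y , Vy , y≡t
  ... | no  y≢t = walk-crosses p (E-closed e) t (≤-trans (pos-step e) (≤∧≢⇒< y≤t y≢t)) t≤z

  spread-bound : Connected V E → ∀ {k} (φ : Fin k → Fin n) → (∀ v → V v → ∃ λ u → φ u ≡ v) →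
                 ∀ {y z} → V y → V z → pos z < pos y + k
  spread-bound conn {k} φ covers {y} {z} Vy Vz with pos y + k ≤? pos z
  ... | no  z<y+k = ≰⇒> z<y+k
  ... | yes y+k≤z = contradiction level (levels-exceed-cover V pos φ covers (pos y))
    where
    level : (t : Fin (suc k)) → ∃ λ w → V w × pos w ≡ pos y + toℕ t
    level t = walk-crosses (conn y z Vy Vz) Vy (pos y + toℕ t) (m≤m+n (pos y) (toℕ t))
                (≤-trans (+-monoʳ-≤ (pos y) (toℕ≤pred[n] t)) y+k≤z)

-- Relabelling subgraphs along an involution

∈⇔lookup : ∀ {n} {x : Fin n} {p : Subset n} → x ∈ p ⇔ lookup p x ≡ true
∈⇔lookup {x = x} {p} = mk⇔ []=⇒lookup (lookup⇒[]= x p)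

∈-tabulate : ∀ {n} {f : Fin n → Bool} {x} → x ∈ tabulate f ⇔ f x ≡ true
∈-tabulate {f = f} {x} = mk⇔
  (λ x∈ → trans (sym (lookup∘tabulate f x)) ([]=⇒lookup x∈))
  (λ fx → lookup⇒[]= x _ (trans (lookup∘tabulate f x) fx))

sum-tabulate : ∀ n (f : Fin n → ℕ) → sum (List.tabulate f) ≡ MonoidSum.sum +-0-commutativeMonoid f
sum-tabulate zero    f = refl
sum-tabulate (suc n) f = cong (f zero +_) (sum-tabulate n (f ∘ suc))

sum-allFin : ∀ n (f : Fin n → ℕ) → sum (map f (allFin n)) ≡ MonoidSum.sum +-0-commutativeMonoid f
sum-allFin n f = trans (cong sum (List.map-tabulate id f)) (sum-tabulate n f)

module Relabel {n} (σ : Fin n → Fin n) (σ-involutive : ∀ v → σ (σ v) ≡ v) where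

  σ-injective : Injective _≡_ _≡_ σ
  σ-injective {x} {y} eq = trans (sym (σ-involutive x)) (trans (cong σ eq) (σ-involutive y))

  sum-∘σ : (f : Fin n → ℕ) → sum (map f (allFin n)) ≡ sum (map (f ∘ σ) (allFin n))
  sum-∘σ f = begin
    sum (map f (allFin n))                      ≡⟨ sum-allFin n f ⟩
    MonoidSum.sum +-0-commutativeMonoid f       ≡⟨ MonoidSum.sum-permute +-0-commutativeMonoid f π ⟩
    MonoidSum.sum +-0-commutativeMonoid (f ∘ σ) ≡⟨ sum-allFin n (f ∘ σ) ⟨
    sum (map (f ∘ σ) (allFin n))                ∎
    where
    open ≡-Reasoning
    π : Permutation n n
    π = permutation σ σ σ-involutive σ-involutive

  relabel : Sub n → Sub n
  relabel S = sub (tabulate λ w → lookup (vs S) (σ w))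
                  (tabulate λ u → tabulate λ w → lookup (lookup (es S) (σ u)) (σ w))

  relabel-involutive : ∀ S → relabel (relabel S) ≡ S
  relabel-involutive (sub V E) = cong₂ sub
    (trans (tabulate-cong λ w → trans (lookup∘tabulate _ (σ w)) (cong (lookup V) (σ-involutive w)))
           (tabulate∘lookup V))
    (trans (tabulate-cong λ u → trans (tabulate-cong λ w → begin
              lookup (lookup (tabulate _) (σ u)) (σ w) ≡⟨ cong (λ r → lookup r (σ w)) (lookup∘tabulate _ (σ u)) ⟩
              lookup (tabulate _) (σ w)                ≡⟨ lookup∘tabulate _ (σ w) ⟩
              lookup (lookup E (σ (σ u))) (σ (σ w))    ≡⟨ cong₂ (λ x y → lookup (lookup E x) y)
                                                                (σ-involutive u) (σ-involutive w) ⟩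
              lookup (lookup E u) w                    ∎)
             (tabulate∘lookup (lookup E u)))
           (tabulate∘lookup E))
    where open ≡-Reasoning

  lookup-relabel : ∀ S v → lookup (vs (relabel S)) v ≡ lookup (vs S) (σ v)
  lookup-relabel S v = lookup∘tabulate _ v

  SVert-relabel : ∀ S v → SVert (relabel S) v ⇔ SVert S (σ v)
  SVert-relabel S v = mk⇔
    (Equivalence.from ∈⇔lookup ∘ Equivalence.to ∈-tabulate)
    (Equivalence.from ∈-tabulate ∘ Equivalence.to ∈⇔lookup)

  SEdge-relabel : ∀ S u v → SEdge (relabel S) u v ⇔ SEdge S (σ u) (σ v)
  SEdge-relabel S u v = mk⇔
    (Equivalence.from ∈⇔lookup ∘ Equivalence.to ∈-tabulate ∘ subst (v ∈_) row)
    (subst (v ∈_) (sym row) ∘ Equivalence.from ∈-tabulate ∘ Equivalence.to ∈⇔lookup)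
    where
    row : lookup (es (relabel S)) u ≡ tabulate λ w → lookup (lookup (es S) (σ u)) (σ w)
    row = lookup∘tabulate (λ u → tabulate λ w → lookup (lookup (es S) (σ u)) (σ w)) u

  SVert-relabel⁺ : ∀ S {v} → SVert S v → SVert (relabel S) (σ v)
  SVert-relabel⁺ S {v} = Equivalence.from (SVert-relabel S (σ v)) ∘ subst (SVert S) (sym (σ-involutive v))

  SEdge-relabel⁺ : ∀ S {u v} → SEdge S u v → SEdge (relabel S) (σ u) (σ v)
  SEdge-relabel⁺ S {u} {v} = Equivalence.from (SEdge-relabel S (σ u) (σ v))
                           ∘ subst₂ (SEdge S) (sym (σ-involutive u)) (sym (σ-involutive v))

  Agrees : Graph n → Graph n → Fin n → Set
  Agrees T T′ u = ∀ w → adj T′ (σ u) (σ w) ≡ adj T u w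

  Agrees-swap : ∀ {T T′ u} → Agrees T T′ (σ u) → Agrees T′ T u
  Agrees-swap {T} {T′} {u} agree w =
    sym (trans (sym (cong₂ (adj T′) (σ-involutive u) (σ-involutive w))) (agree (σ w)))

  module _ {T T′ : Graph n} where

    deg-agrees : ∀ {u} → Agrees T T′ u → deg T′ (σ u) ≡ deg T u
    deg-agrees {u} agree = trans (sum-∘σ (λ w → if adj T′ (σ u) w then 1 else 0))
      (cong sum (List.map-cong (λ w → cong (λ b → if b then 1 else 0) (agree w)) (allFin n)))

    module _ (S : Sub n) (agree : ∀ u → SVert S u → Agrees T T′ u) where

      relabel-subtree : IsSubtree T S → IsSubtree T′ (relabel S)
      relabel-subtree ((E-sym , E⊆T , E-ends) , (v₀ , v₀∈S) , conn , acyclic) =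
        (E-sym′ , E⊆T′ , E-ends′) , (σ v₀ , SVert-relabel⁺ S v₀∈S) , conn′ , acyclic′
        where
        S′ : Sub n
        S′ = relabel S
        back : ∀ {u v} → SEdge S′ u v → SEdge S (σ u) (σ v)
        back {u} {v} = Equivalence.to (SEdge-relabel S u v)
        E-sym′ : ∀ u v → SEdge S′ u v → SEdge S′ v u
        E-sym′ u v = Equivalence.from (SEdge-relabel S v u) ∘ E-sym _ _ ∘ back
        E⊆T′ : ∀ u v → SEdge S′ u v → Adj T′ u v
        E⊆T′ u v e = subst₂ (Adj T′) (σ-involutive u) (σ-involutive v)
          (trans (agree (σ u) (proj₁ (E-ends _ _ (back e))) (σ v)) (E⊆T _ _ (back e)))
        E-ends′ : ∀ u v → SEdge S′ u v → SVert S′ u × SVert S′ v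
        E-ends′ u v e = Equivalence.from (SVert-relabel S u) (proj₁ (E-ends _ _ (back e)))
                      , Equivalence.from (SVert-relabel S v) (proj₂ (E-ends _ _ (back e)))
        conn′ : Connected (SVert S′) (SEdge S′)
        conn′ u v u∈ v∈ = subst₂ (Walk (SEdge S′)) (σ-involutive u) (σ-involutive v)
          (mapʷ σ (SEdge-relabel⁺ S) (conn (σ u) (σ v) (Equivalence.to (SVert-relabel S u) u∈)
                                                        (Equivalence.to (SVert-relabel S v) v∈)))
        acyclic′ : Acyclic (SEdge S′)
        acyclic′ C = acyclic record
          { len = len ; c = σ ∘ c ; inj = inj ∘ σ-injective
          ; edges = back ∘ edges ; close = back close }
          where open Cycle C

      relabel-embedding : ∀ {k} {D : Graph k} {a φ} →
        IsDegreeEmbeddingOnto D a T S φ → IsDegreeEmbeddingOnto D a T′ (relabel S) (σ ∘ φ)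
      relabel-embedding {D = D} {a} {φ} (φ-inj , φ-onto , φ-edges , φ-deg) =
        φ-inj ∘ σ-injective , onto′ , edges′ , deg′
        where
        onto′ : ∀ v → SVert (relabel S) v ⇔ ∃ λ u → σ (φ u) ≡ v
        onto′ v = mk⇔
          (λ v∈ → let u , φu≡σv = Equivalence.to (φ-onto (σ v)) (Equivalence.to (SVert-relabel S v) v∈)
                  in u , trans (cong σ φu≡σv) (σ-involutive v))
          (λ { (u , σφu≡v) → Equivalence.from (SVert-relabel S v)
                 (Equivalence.from (φ-onto (σ v)) (u , trans (sym (σ-involutive (φ u))) (cong σ σφu≡v))) })
        edges′ : ∀ u u′ → SEdge (relabel S) (σ (φ u)) (σ (φ u′)) ⇔ Adj D u u′
        edges′ u u′ = mk⇔
          (Equivalence.to (φ-edges u u′) ∘ subst₂ (SEdge S) (σ-involutive (φ u)) (σ-involutive (φ u′))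
                                          ∘ Equivalence.to (SEdge-relabel S _ _))
          (SEdge-relabel⁺ S ∘ Equivalence.from (φ-edges u u′))
        deg′ : ∀ u → a u ≡ deg T′ (σ (φ u))
        deg′ u = trans (φ-deg u)
          (sym (deg-agrees (agree (φ u) (Equivalence.from (φ-onto (φ u)) (u , refl)))))

      relabel-degreeImage : ∀ {k} {D : Graph k} {a} →
                            IsDegreeImage D a T S → IsDegreeImage D a T′ (relabel S)
      relabel-degreeImage {D = D} {a} (subtree , φ , embedding) =
        relabel-subtree subtree , σ ∘ φ , relabel-embedding {D = D} {a} embedding

relabel-id : ∀ {n} (S : Sub n) → Relabel.relabel id (λ _ → refl) S ≡ S
relabel-id (sub V E) = cong₂ sub (tabulate∘lookup V)
  (trans (tabulate-cong λ u → tabulate∘lookup (lookup E u)) (tabulate∘lookup E))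

module SwapCriterion {n} (σ : Fin n → Fin n) (σ-involutive : ∀ v → σ (σ v) ≡ v)
  (meets : Sub n → Bool) (meets-relabel : ∀ S → meets (Relabel.relabel σ σ-involutive S) ≡ meets S)
  (Near Far : Fin n → Set) (Near-σ : ∀ {u} → Near u → Near (σ u)) where

  open Relabel σ σ-involutive

  swapIfMeets : Sub n → Sub n
  swapIfMeets S = if meets S then relabel S else S

  swapIfMeets-involutive : ∀ S → swapIfMeets (swapIfMeets S) ≡ S
  swapIfMeets-involutive S with meets S in eq
  ... | true  rewrite meets-relabel S | eq = relabel-involutive S
  ... | false rewrite eq = refl

  module _ {k} {D : Graph k} {a : Fin k → ℕ} {T T′ : Graph n}
    (near-agrees : ∀ {u} → Near u → Agrees T T′ u)
    (far-agrees : ∀ {u} → Far u → ∀ w → adj T′ u w ≡ adj T u w)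
    (meets⇒near : ∀ S → IsDegreeImage D a T S → meets S ≡ true → ∀ v → SVert S v → Near v)
    (¬meets⇒far : ∀ S → meets S ≡ false → ∀ v → SVert S v → Far v) where

    swapIfMeets-degreeImage : ∀ S → IsDegreeImage D a T S → IsDegreeImage D a T′ (swapIfMeets S)
    swapIfMeets-degreeImage S img with meets S in eq
    ... | true  = relabel-degreeImage {T = T} {T′} S
                    (λ u u∈S → near-agrees (meets⇒near S img eq u u∈S)) {D = D} {a} img
    ... | false = subst (IsDegreeImage D a T′) (relabel-id S)
                    (Relabel.relabel-degreeImage id (λ _ → refl) {T = T} {T′} S
                      (λ u u∈S → far-agrees (¬meets⇒far S eq u u∈S)) {D = D} {a} img)

  sameDegreeEmbeddingNumber-bySwap : ∀ {k} {D : Graph k} {a : Fin k → ℕ} {T T′ : Graph n} →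
    (∀ {u} → Near u → Agrees T T′ u) →
    (∀ {u} → Far u → ∀ w → adj T′ u w ≡ adj T u w) →
    (∀ S → IsDegreeImage D a T S → meets S ≡ true → ∀ v → SVert S v → Near v) →
    (∀ S → IsDegreeImage D a T′ S → meets S ≡ true → ∀ v → SVert S v → Near v) →
    (∀ S → meets S ≡ false → ∀ v → SVert S v → Far v) →
    SameDegreeEmbeddingNumber D a T T′
  sameDegreeEmbeddingNumber-bySwap {D = D} {a} {T} {T′}
    near-agrees far-agrees meets⇒near meets⇒near′ ¬meets⇒far =
    swapIfMeets , swapIfMeets ,
    (λ S img → forth S img , swapIfMeets-involutive S) ,
    (λ S img → back S img , swapIfMeets-involutive S)
    where
    forth : ∀ S → IsDegreeImage D a T S → IsDegreeImage D a T′ (swapIfMeets S)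
    forth = swapIfMeets-degreeImage {D = D} {a} {T} {T′} near-agrees far-agrees meets⇒near ¬meets⇒far
    back : ∀ S → IsDegreeImage D a T′ S → IsDegreeImage D a T (swapIfMeets S)
    back = swapIfMeets-degreeImage {D = D} {a} {T′} {T}
             (λ {u} near → Agrees-swap {T} {T′} {u} (near-agrees (Near-σ near)))
             (λ far w → sym (far-agrees far w)) meets⇒near′ ¬meets⇒far

-- Arms: paths from a leaf through vertices of degree 2

record Arm {n} (G : Graph n) (K : ℕ) : Set where
  field
    p        : ℕ → Fin n
    steps    : ∀ j → j < K → Adj G (p j) (p (suc j))
    tip      : ∀ w → Adj G (p 0) w → w ≡ p 1
    inner    : ∀ j → 0 < j → j < K → ∀ w → Adj G (p j) w → w ≡ p (pred j) ⊎ w ≡ p (suc j)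
    distinct : ∀ {i j} → i ≤ K → j ≤ K → p i ≡ p j → i ≡ j

arm-iso : ∀ {n₁ n₂} {G : Graph n₁} {H : Graph n₂} {K} → Iso G H → Arm G K → Arm H K
arm-iso {G = G} {H} (f , preserves) A = record
  { p        = to ∘ p
  ; steps    = λ j j<K → trans (preserves _ _) (steps j j<K)
  ; tip      = λ w adj → moved (tip (from w) (pulled adj))
  ; inner    = λ j 0<j j<K w adj → Sum.map moved moved (inner j 0<j j<K (from w) (pulled adj))
  ; distinct = λ i≤K j≤K eq → distinct i≤K j≤K
                 (trans (sym (inverseʳ refl)) (trans (cong from eq) (inverseʳ refl)))
  }
  where
  open Arm A
  open Inverse f
  pulled : ∀ {u w} → Adj H (to u) w → Adj G u (from w)
  pulled {u} {w} adj =
    trans (sym (preserves u (from w))) (subst (Adj H (to u)) (sym (inverseˡ refl)) adj)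
  moved : ∀ {w v} → from w ≡ v → w ≡ to v
  moved {w} eq = trans (sym (inverseˡ refl)) (cong to eq)

module _ {A : Set} (R : A → A → Set) (p ℓ : ℕ → A) (J : ℕ)
  (start : p 0 ≡ ℓ 0) (first : p 1 ≡ ℓ 1)
  (steps : ∀ j → j < J → R (p j) (p (suc j)))
  (no-return : ∀ j → suc (suc j) ≤ J → p (suc (suc j)) ≢ p j)
  (ℓ-inner : ∀ j → 0 < j → j < J → ∀ {y} → R (ℓ j) y → y ≡ ℓ (pred j) ⊎ y ≡ ℓ (suc j)) where

  follow-arm : ∀ j → j ≤ J → p j ≡ ℓ j
  follow-arm zero    _     = start
  follow-arm (suc j) 1+j≤J = proj₂ (follow j 1+j≤J)
    where
    follow : ∀ j → suc j ≤ J → p j ≡ ℓ j × p (suc j) ≡ ℓ (suc j)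
    follow zero    _     = start , first
    follow (suc j) 2+j≤J with pⱼ≡ℓⱼ , pⱼ₊₁≡ℓⱼ₊₁ ← follow j (<⇒≤ 2+j≤J)
      with ℓ-inner (suc j) z<s 2+j≤J (subst (λ x → R x _) pⱼ₊₁≡ℓⱼ₊₁ (steps (suc j) 2+j≤J))
    ... | inj₁ back    = contradiction (trans back (sym pⱼ≡ℓⱼ)) (no-return j 2+j≤J)
    ... | inj₂ forward = pⱼ₊₁≡ℓⱼ₊₁ , forward

three-distinct-in-two : ∀ {A : Set} {x y z a b : A} → x ≢ y → x ≢ z → y ≢ z →
  x ≡ a ⊎ x ≡ b → y ≡ a ⊎ y ≡ b → z ≡ a ⊎ z ≡ b → ⊥
three-distinct-in-two x≢y x≢z y≢z (inj₁ xa) (inj₁ ya) _         = x≢y (trans xa (sym ya))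
three-distinct-in-two x≢y x≢z y≢z (inj₂ xb) (inj₂ yb) _         = x≢y (trans xb (sym yb))
three-distinct-in-two x≢y x≢z y≢z (inj₁ xa) (inj₂ yb) (inj₁ za) = x≢z (trans xa (sym za))
three-distinct-in-two x≢y x≢z y≢z (inj₁ xa) (inj₂ yb) (inj₂ zb) = y≢z (trans yb (sym zb))
three-distinct-in-two x≢y x≢z y≢z (inj₂ xb) (inj₁ ya) (inj₁ za) = y≢z (trans ya (sym za))
three-distinct-in-two x≢y x≢z y≢z (inj₂ xb) (inj₁ ya) (inj₂ zb) = x≢z (trans xb (sym zb))

-- The trees

-- pendantPath c: the path 0 — 1 — ⋯ — L together with the leaf X = L + 1 attached at c.
module PendantPath (L : ℕ) where

  X : ℕ
  X = suc L

  data Link (c : ℕ) : ℕ → ℕ → Set where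
    path⁺ : ∀ {i} → suc i ≤ L → Link c i (suc i)
    path⁻ : ∀ {i} → suc i ≤ L → Link c (suc i) i
    leaf⁺ : Link c c X
    leaf⁻ : Link c X c

  link-sym : ∀ {c i j} → Link c i j → Link c j i
  link-sym (path⁺ p) = path⁻ p
  link-sym (path⁻ p) = path⁺ p
  link-sym leaf⁺     = leaf⁻
  link-sym leaf⁻     = leaf⁺

  link-cong : ∀ {c c′ i i′ j j′} → c ≡ c′ → i ≡ i′ → j ≡ j′ → Link c i j → Link c′ i′ j′
  link-cong refl refl refl l = l

  link-irrefl : ∀ {c i} → c ≤ L → ¬ Link c i i
  link-irrefl c≤L leaf⁺ = 1+n≰n c≤L
  link-irrefl c≤L leaf⁻ = 1+n≰n c≤L

  link? : ∀ c i j → Dec (Link c i j)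
  link? c i j = map′ fromCases toCases
    (((suc i ≟ j) ×-dec (j ≤? L)) ⊎-dec ((suc j ≟ i) ×-dec (i ≤? L)) ⊎-dec
     ((i ≟ c) ×-dec (j ≟ X)) ⊎-dec ((i ≟ X) ×-dec (j ≟ c)))
    where
    Cases : Set
    Cases = (suc i ≡ j × j ≤ L) ⊎ (suc j ≡ i × i ≤ L) ⊎ (i ≡ c × j ≡ X) ⊎ (i ≡ X × j ≡ c)
    fromCases : Cases → Link c i j
    fromCases (inj₁ (refl , p))                  = path⁺ p
    fromCases (inj₂ (inj₁ (refl , p)))           = path⁻ p
    fromCases (inj₂ (inj₂ (inj₁ (refl , refl)))) = leaf⁺
    fromCases (inj₂ (inj₂ (inj₂ (refl , refl)))) = leaf⁻
    toCases : Link c i j → Cases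
    toCases (path⁺ p) = inj₁ (refl , p)
    toCases (path⁻ p) = inj₂ (inj₁ (refl , p))
    toCases leaf⁺     = inj₂ (inj₂ (inj₁ (refl , refl)))
    toCases leaf⁻     = inj₂ (inj₂ (inj₂ (refl , refl)))

  link-bounded : ∀ {c i j} → c ≤ L → Link c i j → j < suc X
  link-bounded c≤L (path⁺ p) = s≤s (m≤n⇒m≤1+n p)
  link-bounded c≤L (path⁻ p) = m≤n⇒m≤1+n (m≤n⇒m≤1+n p)
  link-bounded c≤L leaf⁺     = ≤-refl
  link-bounded c≤L leaf⁻     = s≤s (m≤n⇒m≤1+n c≤L)

  pendantPath : (c : ℕ) → c ≤ L → Graph (suc X)
  pendantPath c c≤L = record
    { adj    = λ u v → does (link? c (toℕ u) (toℕ v))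
    ; sym    = λ u v → does-⇔ (mk⇔ link-sym link-sym)
                                (link? c (toℕ u) (toℕ v)) (link? c (toℕ v) (toℕ u))
    ; irrefl = λ v → dec-false (link? c (toℕ v) (toℕ v)) (link-irrefl c≤L)
    }

  ifX_then_else_ : ℕ → ℕ → ℕ → ℕ
  ifX i then x else y with i ≟ X
  ... | yes _ = x
  ... | no  _ = y

  ifX-X : ∀ {x y} → (ifX X then x else y) ≡ x
  ifX-X with X ≟ X
  ... | yes _   = refl
  ... | no  X≢X = contradiction refl X≢X

  ifX-path : ∀ {i x y} → i ≤ L → (ifX i then x else y) ≡ y
  ifX-path {i} i≤L with i ≟ X
  ... | yes refl = contradiction i≤L 1+n≰n
  ... | no  _    = refl

  path-or-X : ∀ {i} → i < suc X → i ≤ L ⊎ i ≡ X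
  path-or-X {i} i<2+L with i ≤? L
  ... | yes i≤L = inj₁ i≤L
  ... | no  i≰L = inj₂ (≤-antisym (s≤s⁻¹ i<2+L) (≰⇒> i≰L))

  interior-link : ∀ {c i y} → 0 < i → i < L → i ≢ c → Link c i y → y ≡ pred i ⊎ y ≡ suc i
  interior-link _ _   _   (path⁺ _) = inj₂ refl
  interior-link _ _   _   (path⁻ _) = inj₁ refl
  interior-link _ _   i≢c leaf⁺     = contradiction refl i≢c
  interior-link _ X<L _   leaf⁻     = contradiction (<⇒≤ X<L) 1+n≰n

  L∸-link : ∀ {c j} → j < L → Link c (L ∸ j) (L ∸ suc j)
  L∸-link {c} {j} j<L =
    link-cong refl (sym L∸j≡1+L∸1+j) refl (path⁻ (subst (_≤ L) L∸j≡1+L∸1+j (m∸n≤m L j)))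
    where
    L∸j≡1+L∸1+j : L ∸ j ≡ suc (L ∸ suc j)
    L∸j≡1+L∸1+j = +-∸-assoc 1 j<L

  module _ {c : ℕ} (c≤L : c ≤ L) where

    L∸-interior-link : ∀ {j y} → 0 < j → j < L ∸ c → Link c (L ∸ j) y → y ≡ L ∸ pred j ⊎ y ≡ L ∸ suc j
    L∸-interior-link {suc j} 0<j j<L∸c l =
      Sum.swap (Sum.map (λ y≡pred → trans y≡pred (pred[m∸n]≡m∸[1+n] L (suc j)))
                        (λ y≡suc → trans y≡suc (sym (+-∸-assoc 1 (<-trans (n<1+n j) 1+j<L))))
                        (interior-link (m<n⇒0<n∸m 1+j<L) (∸-monoʳ-< 0<j (<⇒≤ 1+j<L)) (≢-sym (<⇒≢ c<L∸j)) l))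
      where
      1+j<L : suc j < L
      1+j<L = ≤-trans j<L∸c (m∸n≤m L c)
      c<L∸j : c < L ∸ suc j
      c<L∸j = m+n≤o⇒m≤o∸n (suc c)
        (subst (_≤ L) (cong suc (+-comm (suc j) c)) (m≤o∸n⇒m+n≤o (suc (suc j)) c≤L j<L∸c))

    height : ℕ → ℕ
    height i = ifX i then suc c else i

    parent : ℕ → ℕ
    parent i = ifX i then c else pred i

    link-height : ∀ {i j} → Link c i j → height i ≢ height j
    link-height (path⁺ p) eq = <⇒≢ (n<1+n _) (trans (sym (ifX-path (<⇒≤ p))) (trans eq (ifX-path p)))
    link-height (path⁻ p) eq = <⇒≢ (n<1+n _) (trans (sym (ifX-path (<⇒≤ p))) (trans (sym eq) (ifX-path p)))
    link-height leaf⁺     eq = <⇒≢ (n<1+n c) (trans (sym (ifX-path c≤L)) (trans eq ifX-X))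
    link-height leaf⁻     eq = <⇒≢ (n<1+n c) (trans (sym (ifX-path c≤L)) (trans (sym eq) ifX-X))

    pos : ℕ → ℕ
    pos i = ifX i then c else i

    pos-step : ∀ {i j} → Link c i j → pos j ≤ suc (pos i)
    pos-step (path⁺ p) = ≤-reflexive (trans (ifX-path p) (cong suc (sym (ifX-path (<⇒≤ p)))))
    pos-step (path⁻ p) = subst₂ (λ a b → a ≤ suc b) (sym (ifX-path (<⇒≤ p))) (sym (ifX-path p)) (m≤n+m _ 2)
    pos-step leaf⁺     = subst₂ (λ a b → a ≤ suc b) (sym ifX-X) (sym (ifX-path c≤L)) (n≤1+n c)
    pos-step leaf⁻     = subst₂ (λ a b → a ≤ suc b) (sym (ifX-path c≤L)) (sym ifX-X) (n≤1+n c)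

    link-down : ∀ {i j} → Link c i j → height j < height i → j ≡ parent i
    link-down (path⁺ p) lt = contradiction (subst₂ _<_ (ifX-path p) (ifX-path (<⇒≤ p)) lt) (<-asym (n<1+n _))
    link-down (path⁻ p) lt = sym (ifX-path p)
    link-down leaf⁺     lt = contradiction (subst₂ _<_ ifX-X (ifX-path c≤L) lt) (<-asym (n<1+n c))
    link-down leaf⁻     lt = sym ifX-X

    private
      T : Graph (suc X)
      T = pendantPath c c≤L

    adj⇔link : ∀ u v → Adj T u v ⇔ Link c (toℕ u) (toℕ v)
    adj⇔link u v = mk⇔
      (λ adj≡true → invert (subst (Reflects _) adj≡true (proof (link? c (toℕ u) (toℕ v)))))
      (dec-true (link? c (toℕ u) (toℕ v)))

    adj-fromℕ< : ∀ {i j} (i< : i < suc X) (j< : j < suc X) → Link c i j → Adj T (fromℕ< i<) (fromℕ< j<)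
    adj-fromℕ< i< j< =
      Equivalence.from (adj⇔link _ _) ∘ link-cong refl (sym (toℕ-fromℕ< i<)) (sym (toℕ-fromℕ< j<))

    walk-down : ∀ {i} (i< : i < suc X) → i ≤ L → Walk (Adj T) (fromℕ< i<) zero
    walk-down {zero}  _   _     = here
    walk-down {suc i} i< 1+i≤L = step (adj-fromℕ< i< i<′ (path⁻ 1+i≤L)) (walk-down i<′ (<⇒≤ 1+i≤L))
      where
      i<′ : i < suc X
      i<′ = <-trans (n<1+n i) i<

    walk-to-0 : ∀ v → Walk (Adj T) v zero
    walk-to-0 v with path-or-X (toℕ<n v)
    ... | inj₁ v≤L = subst (λ w → Walk (Adj T) w zero) (fromℕ<-toℕ v (toℕ<n v)) (walk-down (toℕ<n v) v≤L)
    ... | inj₂ v≡X = step (Equivalence.from (adj⇔link v (fromℕ< c<))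
                                (link-cong refl (sym v≡X) (sym (toℕ-fromℕ< c<)) leaf⁻))
                          (walk-down c< c≤L)
      where
      c< : c < suc X
      c< = s≤s (m≤n⇒m≤1+n c≤L)

    pendantPath-isTree : IsTree T
    pendantPath-isTree =
      (zero , tt) ,
      (λ u v _ _ → walk-to-0 u ++ʷ reverseʷ (λ {u} {v} → trans (Graph.sym T v u)) (walk-to-0 v)) ,
      height⇒acyclic (height ∘ toℕ) (λ {u} {v} → link-height ∘ Equivalence.to (adj⇔link u v)) lower-unique
      where
      toLink : ∀ {u v} → Linked (Adj T) u v → Link c (toℕ u) (toℕ v)
      toLink {u} {v} (inj₁ uv) = Equivalence.to (adj⇔link u v) uv
      toLink {u} {v} (inj₂ vu) = link-sym (Equivalence.to (adj⇔link v u) vu)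
      lower-unique : ∀ {u v w} → Linked (Adj T) u v → height (toℕ v) < height (toℕ u) →
                     Linked (Adj T) u w → height (toℕ w) < height (toℕ u) → v ≡ w
      lower-unique uv v< uw w< =
        toℕ-injective (trans (link-down (toLink uv) v<) (sym (link-down (toLink uw) w<)))

    hub-degree : 0 < c → c < L → ∀ {a b} → ¬ (∀ {y} → Link c c y → y ≡ a ⊎ y ≡ b)
    hub-degree (s≤s {n = c′} _) c<L only-two =
      three-distinct-in-two (<⇒≢ (m<n+m c′ {2} z<s)) (<⇒≢ (<-trans (<-trans (n<1+n c′) c<L) (n<1+n L)))
                            (<⇒≢ (s≤s c<L))
                            (only-two (path⁻ (<⇒≤ c<L))) (only-two (path⁺ c<L)) (only-two leaf⁺)

    leaf-cases : ∀ {i q} → (∀ {y} → Link c i y → y ≡ q) → i < suc X → i ≡ 0 ⊎ i ≡ L ⊎ i ≡ X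
    leaf-cases {zero}  _      _     = inj₁ refl
    leaf-cases {suc i} unique i<2+L with path-or-X i<2+L | suc i ≟ L
    ... | inj₂ i≡X | _       = inj₂ (inj₂ i≡X)
    ... | inj₁ _   | yes i≡L = inj₂ (inj₁ i≡L)
    ... | inj₁ i≤L | no  i≢L =
      contradiction (trans (unique (path⁻ i≤L)) (sym (unique (path⁺ (≤∧≢⇒< i≤L i≢L))))) (<⇒≢ (m<n+m i {2} z<s))

    adj-fromLink : ∀ (u : Fin (suc X)) {y} (l : Link c (toℕ u) y) → Adj T u (fromℕ< (link-bounded c≤L l))
    adj-fromLink u l = Equivalence.from (adj⇔link _ _) (subst (Link c (toℕ u)) (sym (toℕ-fromℕ< _)) l)

    fromLink-≡ : ∀ (u : Fin (suc X)) {y v} (l : Link c (toℕ u) y) → fromℕ< (link-bounded c≤L l) ≡ v → y ≡ toℕ v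
    fromLink-≡ u l eq = trans (sym (toℕ-fromℕ< (link-bounded c≤L l))) (cong toℕ eq)

    long-arm : c < L → Arm T (L ∸ c)
    long-arm c<L = record
      { p        = p
      ; steps    = λ j j<K → Equivalence.from (adj⇔link _ _)
                     (link-cong refl (sym (toℕ-p j)) (sym (toℕ-p (suc j))) (L∸-link (≤-trans j<K L∸c≤L)))
      ; tip      = λ w → to-p {1} ∘ leaf-L ∘ from-p {0}
      ; inner    = λ j 0<j j<K w → Sum.map (to-p {pred j}) (to-p {suc j}) ∘ L∸-interior-link 0<j j<K ∘ from-p {j}
      ; distinct = λ {i} {j} i≤K j≤K eq → ∸-cancelˡ-≡ (≤-trans i≤K L∸c≤L) (≤-trans j≤K L∸c≤L)
                     (trans (sym (toℕ-p i)) (trans (cong toℕ eq) (toℕ-p j)))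
      }
      where
      L∸c≤L : L ∸ c ≤ L
      L∸c≤L = m∸n≤m L c
      p : ℕ → Fin (suc X)
      p j = fromℕ< (s≤s (m≤n⇒m≤1+n (m∸n≤m L j)))
      toℕ-p : ∀ j → toℕ (p j) ≡ L ∸ j
      toℕ-p j = toℕ-fromℕ< _
      from-p : ∀ {j w} → Adj T (p j) w → Link c (L ∸ j) (toℕ w)
      from-p {j} {w} = link-cong refl (toℕ-p j) refl ∘ Equivalence.to (adj⇔link (p j) w)
      to-p : ∀ {j w} → toℕ w ≡ L ∸ j → w ≡ p j
      to-p {j} w≡L∸j = toℕ-injective (trans w≡L∸j (sym (toℕ-p j)))
      leaf-L : ∀ {y} → Link c L y → y ≡ L ∸ 1
      leaf-L (path⁺ L<L) = contradiction L<L 1+n≰n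
      leaf-L (path⁻ _)   = refl
      leaf-L leaf⁺       = contradiction refl (<⇒≢ c<L)

    -- The arm starts at a leaf 0, L or X of T, and its inner vertices are forced along the path from that
    -- leaf, which meets the hub c (of degree 3) before its length K is used up.
    no-long-arm : ∀ {K} → 0 < c → c < L → c < K → L ∸ c < K → ¬ Arm T K
    no-long-arm {K} 0<c c<L c<K L∸c<K A = from-leaf (leaf-cases tipℕ (toℕ<n (p 0)))
      where
      open Arm A
      W : ℕ → ℕ
      W = toℕ ∘ p
      tipℕ : ∀ {y} → Link c (W 0) y → y ≡ W 1
      tipℕ l = fromLink-≡ (p 0) l (tip _ (adj-fromLink (p 0) l))
      innerℕ : ∀ j → 0 < j → j < K → ∀ {y} → Link c (W j) y → y ≡ W (pred j) ⊎ y ≡ W (suc j)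
      innerℕ j 0<j j<K l =
        Sum.map (fromLink-≡ (p j) l) (fromLink-≡ (p j) l) (inner j 0<j j<K _ (adj-fromLink (p j) l))
      reach : (ℓ : ℕ → ℕ) (J : ℕ) → 0 < J → J < K → W 0 ≡ ℓ 0 → Link c (ℓ 0) (ℓ 1) → ℓ J ≡ c →
              (∀ j → 0 < j → j < J → ∀ {y} → Link c (ℓ j) y → y ≡ ℓ (pred j) ⊎ y ≡ ℓ (suc j)) → ⊥
      reach ℓ J 0<J J<K start first end ℓ-inner =
        hub-degree 0<c c<L (innerℕ J 0<J J<K ∘ subst (λ i → Link c i _) (sym (trans W≡ℓ end)))
        where
        no-return : ∀ j → suc (suc j) ≤ J → W (suc (suc j)) ≢ W j
        no-return j 2+j≤J eq =
          <⇒≢ (m<n+m j {2} z<s) (sym (distinct 2+j≤K (≤-trans (m≤n+m j 2) 2+j≤K) (toℕ-injective eq)))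
          where
          2+j≤K : suc (suc j) ≤ K
          2+j≤K = ≤-trans 2+j≤J (<⇒≤ J<K)
        W≡ℓ : W J ≡ ℓ J
        W≡ℓ = follow-arm (Link c) W ℓ J start (sym (tipℕ (subst (λ i → Link c i (ℓ 1)) (sym start) first)))
                (λ j j<J → Equivalence.to (adj⇔link _ _) (steps j (<-trans j<J J<K)))
                no-return
                ℓ-inner J ≤-refl
      from-leaf : W 0 ≡ 0 ⊎ W 0 ≡ L ⊎ W 0 ≡ X → ⊥
      from-leaf (inj₁ at-0)        =
        reach id c 0<c c<K at-0 (path⁺ (≤-trans 0<c (<⇒≤ c<L))) refl
          (λ j 0<j j<c → interior-link 0<j (<-trans j<c c<L) (<⇒≢ j<c))
      from-leaf (inj₂ (inj₁ at-L)) =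
        reach (L ∸_) (L ∸ c) (m<n⇒0<n∸m c<L) L∸c<K at-L (L∸-link (≤-trans 0<c (<⇒≤ c<L)))
          (m∸[m∸n]≡n (<⇒≤ c<L)) (λ j 0<j j<L∸c → L∸-interior-link 0<j j<L∸c)
      from-leaf (inj₂ (inj₂ at-X)) =
        reach (λ { zero → X ; (suc _) → c }) 1 z<s (≤-trans (s≤s 0<c) c<K) at-X leaf⁻ refl
          (λ { (suc _) _ (s≤s ()) })

module Construction (m : ℕ) where

  B : ℕ
  B = suc (m + m)

  L : ℕ
  L = suc (suc (B + B))

  open PendantPath L public

  c₁ c₂ : ℕ
  c₁ = suc m
  c₂ = B + suc m

  swap : ℕ → ℕ
  swap zero = zero
  swap (suc j) with j <? B | j <? B + B
  ... | yes _ | _     = suc (j + B)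
  ... | no  _ | yes _ = suc (j ∸ B)
  ... | no  _ | no  _ = suc j

  swap-block₁ : ∀ {j} → j < B → swap (suc j) ≡ suc (j + B)
  swap-block₁ {j} j<B with j <? B | j <? B + B
  ... | yes _   | _ = refl
  ... | no  j≮B | _ = contradiction j<B j≮B

  swap-block₂ : ∀ {j} → B ≤ j → j < B + B → swap (suc j) ≡ suc (j ∸ B)
  swap-block₂ {j} B≤j j<2B with j <? B | j <? B + B
  ... | yes j<B | _        = contradiction j<B (≤⇒≯ B≤j)
  ... | no  _   | yes _    = refl
  ... | no  _   | no j≮2B = contradiction j<2B j≮2B

  swap-fixed : ∀ {i} → B + B < i → swap i ≡ i
  swap-fixed {suc j} 2B<1+j with j <? B | j <? B + B
  ... | yes j<B  | _        = contradiction (<-trans j<B (m<m+n B z<s)) (≤⇒≯ (s≤s⁻¹ 2B<1+j))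
  ... | no  _    | yes j<2B = contradiction j<2B (≤⇒≯ (s≤s⁻¹ 2B<1+j))
  ... | no  _    | no  _    = refl

  swap-involutive : ∀ i → swap (swap i) ≡ i
  swap-involutive zero = refl
  swap-involutive (suc j) with j <? B | j <? B + B
  ... | yes j<B | _        = trans (swap-block₂ (m≤n+m B j) (+-monoˡ-< B j<B)) (cong suc (m+n∸n≡m j B))
  ... | no  j≮B | yes j<2B = trans (swap-block₁ (m<n+o⇒m∸n<o j B j<2B)) (cong suc (m∸n+n≡m (≮⇒≥ j≮B)))
  ... | no  _   | no j≮2B = swap-fixed (s≤s (≮⇒≥ j≮2B))

  swap-≤L : ∀ {i} → i ≤ L → swap i ≤ L
  swap-≤L {zero}  _ = z≤n
  swap-≤L {suc j} 1+j≤L with j <? B | j <? B + B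
  ... | yes j<B | _     = ≤-trans (+-monoˡ-< B j<B) (m≤n+m (B + B) 2)
  ... | no  _   | yes _ = ≤-trans (s≤s (m∸n≤m j B)) 1+j≤L
  ... | no  _   | no  _ = 1+j≤L

  swap-< : ∀ {i} → i < suc X → swap i < suc X
  swap-< i<2+L with path-or-X i<2+L
  ... | inj₁ i≤L = s≤s (m≤n⇒m≤1+n (swap-≤L i≤L))
  ... | inj₂ refl = subst (_< suc X) (sym (swap-fixed (m≤n+m _ 2))) ≤-refl

  swap-c₁ : swap c₁ ≡ c₂
  swap-c₁ = trans (swap-block₁ (s≤s (m≤m+n m m))) (trans (cong suc (+-comm m B)) (sym (+-suc B m)))

  -- swap is a translation on i - 1, i, i + 1.
  data Near : ℕ → Set where
    near : ∀ {i} → swap (suc i) ≡ suc (swap i) → swap (suc (suc i)) ≡ suc (swap (suc i)) → Near (suc i)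

  Near-swap : ∀ {i} → Near i → Near (swap i)
  Near-swap (near {i} e₁ e₂) = subst Near (sym e₁) (near e₁′ e₂′)
    where
    open ≡-Reasoning
    e₁′ : swap (suc (swap i)) ≡ suc (swap (swap i))
    e₁′ = begin
      swap (suc (swap i))  ≡⟨ cong swap e₁ ⟨
      swap (swap (suc i))  ≡⟨ swap-involutive (suc i) ⟩
      suc i                ≡⟨ cong suc (swap-involutive i) ⟨
      suc (swap (swap i))  ∎
    e₂′ : swap (suc (suc (swap i))) ≡ suc (swap (suc (swap i)))
    e₂′ = begin
      swap (suc (suc (swap i)))  ≡⟨ cong (swap ∘ suc) e₁ ⟨
      swap (suc (swap (suc i)))  ≡⟨ cong swap e₂ ⟨
      swap (swap (suc (suc i)))  ≡⟨ swap-involutive (suc (suc i)) ⟩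
      suc (suc i)                ≡⟨ cong suc (trans e₁′ (cong suc (swap-involutive i))) ⟨
      suc (swap (suc (swap i)))  ∎

  near-block₁ : ∀ {i} → 1 < i → i < B → Near i
  near-block₁ {suc (suc j)} (s≤s (s≤s _)) 2+j<B =
    near (stable j (<-trans (n<1+n _) 2+j<B)) (stable (suc j) 2+j<B)
    where
    stable : ∀ j → suc j < B → swap (suc (suc j)) ≡ suc (swap (suc j))
    stable j 1+j<B = trans (swap-block₁ 1+j<B) (cong suc (sym (swap-block₁ (<-trans (n<1+n j) 1+j<B))))

  near-block₂ : ∀ {i} → suc B < i → i < B + B → Near i
  near-block₂ {suc (suc j)} (s≤s (s≤s B≤j)) 2+j<2B =
    near (stable j B≤j (<-trans (n<1+n _) 2+j<2B)) (stable (suc j) (m≤n⇒m≤1+n B≤j) 2+j<2B)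
    where
    stable : ∀ j → B ≤ j → suc j < B + B → swap (suc (suc j)) ≡ suc (swap (suc j))
    stable j B≤j 1+j<2B = trans (swap-block₂ (m≤n⇒m≤1+n B≤j) 1+j<2B)
      (cong suc (trans (+-∸-assoc 1 B≤j) (sym (swap-block₂ B≤j (<-trans (n<1+n j) 1+j<2B)))))

  near-X : Near X
  near-X = near (stable (m≤n+m _ 1)) (stable (m≤n+m _ 2))
    where
    stable : ∀ {i} → B + B < i → swap (suc i) ≡ suc (swap i)
    stable 2B<i = trans (swap-fixed (<-trans 2B<i (n<1+n _))) (cong suc (sym (swap-fixed 2B<i)))

  near-window : ∀ {c₀ i} → c₀ ≡ c₁ ⊎ c₀ ≡ c₂ → i < c₀ + m → c₀ < i + m → Near i
  near-window {i = i} (inj₁ refl) i<B c₁<i+m = near-block₁ (+-cancelʳ-< m 1 i c₁<i+m) i<B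
  near-window {i = i} (inj₂ refl) i<c₂+m c₂<i+m =
    near-block₂ (+-cancelʳ-< m (suc B) i (subst (_< i + m) (+-suc B m) c₂<i+m))
                (subst (i <_) (+-assoc B (suc m) m) i<c₂+m)

  swap-link : ∀ {c i j} → Near i → Link c i j → Link (swap c) (swap i) (swap j)
  swap-link (near e₁ e₂) (path⁺ p) = link-cong refl refl (sym e₂) (path⁺ (subst (_≤ L) e₂ (swap-≤L p)))
  swap-link (near e₁ e₂) (path⁻ p) = link-cong refl (sym e₁) refl (path⁻ (subst (_≤ L) e₁ (swap-≤L p)))
  swap-link _            leaf⁺     = link-cong refl refl (sym (swap-fixed (m≤n+m _ 2))) leaf⁺
  swap-link _            leaf⁻     = link-cong refl (sym (swap-fixed (m≤n+m _ 2))) refl leaf⁻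

  swap-link⇔ : ∀ {c c′ i j} → swap c ≡ c′ → Near i → Link c′ (swap i) (swap j) ⇔ Link c i j
  swap-link⇔ {c} {i = i} {j} swap-c≡c′ near-i = mk⇔
    (link-cong (trans (cong swap (sym swap-c≡c′)) (swap-involutive c)) (swap-involutive i) (swap-involutive j)
      ∘ swap-link (Near-swap near-i))
    (link-cong swap-c≡c′ refl refl ∘ swap-link near-i)

  link-far : ∀ {c c′ i j} → i ≢ X → i ≢ c → Link c i j → Link c′ i j
  link-far _   _   (path⁺ p) = path⁺ p
  link-far _   _   (path⁻ p) = path⁻ p
  link-far _   i≢c leaf⁺     = contradiction refl i≢c
  link-far i≢X _   leaf⁻     = contradiction refl i≢X

  σ : Fin (suc X) → Fin (suc X)
  σ v = fromℕ< (swap-< (toℕ<n v))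

  toℕ-σ : ∀ v → toℕ (σ v) ≡ swap (toℕ v)
  toℕ-σ v = toℕ-fromℕ< _

  σ-involutive : ∀ v → σ (σ v) ≡ v
  σ-involutive v = toℕ-injective (trans (toℕ-σ (σ v)) (trans (cong swap (toℕ-σ v)) (swap-involutive (toℕ v))))

  open Relabel σ σ-involutive using (relabel; Agrees; lookup-relabel)

  module _ {c c′} (c≤L : c ≤ L) (c′≤L : c′ ≤ L) where

    σ-agrees : swap c ≡ c′ → ∀ {u} → Near (toℕ u) → Agrees (pendantPath c c≤L) (pendantPath c′ c′≤L) u
    σ-agrees swap-c≡c′ {u} near-u w = does-⇔
      (mk⇔ (Equivalence.to (swap-link⇔ swap-c≡c′ near-u) ∘ link-cong refl (toℕ-σ u) (toℕ-σ w))
           (link-cong refl (sym (toℕ-σ u)) (sym (toℕ-σ w)) ∘ Equivalence.from (swap-link⇔ swap-c≡c′ near-u)))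
      (link? c′ (toℕ (σ u)) (toℕ (σ w))) (link? c (toℕ u) (toℕ w))

    far-agrees : ∀ {u} → toℕ u ≢ X × toℕ u ≢ c × toℕ u ≢ c′ →
                 ∀ w → adj (pendantPath c′ c′≤L) u w ≡ adj (pendantPath c c≤L) u w
    far-agrees {u} (u≢X , u≢c , u≢c′) w =
      does-⇔ (mk⇔ (link-far u≢X u≢c′) (link-far u≢X u≢c)) (link? c′ (toℕ u) (toℕ w)) (link? c (toℕ u) (toℕ w))

  1+c₂+c₁≡L : suc (c₂ + c₁) ≡ L
  1+c₂+c₁≡L = cong suc (begin
    B + suc m + suc m       ≡⟨ +-assoc B (suc m) (suc m) ⟩
    B + suc (m + suc m)     ≡⟨ cong (λ n → B + suc n) (+-suc m m) ⟩
    B + suc (suc (m + m))   ≡⟨ +-suc B (suc (m + m)) ⟩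
    suc (B + B)             ∎)
    where open ≡-Reasoning

  c₁<c₂ : c₁ < c₂
  c₁<c₂ = m<n+m c₁ z<s

  c₂<L : c₂ < L
  c₂<L = m+n≤o⇒m≤o (suc c₂) (≤-reflexive 1+c₂+c₁≡L)

  c₁≤L : c₁ ≤ L
  c₁≤L = <⇒≤ (<-trans c₁<c₂ c₂<L)

  c₂≤L : c₂ ≤ L
  c₂≤L = <⇒≤ c₂<L

  T₁ T₂ : Graph (suc X)
  T₁ = pendantPath c₁ c₁≤L
  T₂ = pendantPath c₂ c₂≤L

  T₁≇T₂ : ¬ Iso T₁ T₂
  T₁≇T₂ iso = no-long-arm c₂≤L z<s c₂<L c₂<L∸c₁ (∸-monoʳ-< c₁<c₂ c₂≤L)
                (arm-iso iso (long-arm c₁≤L (<-trans c₁<c₂ c₂<L)))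
    where
    c₂<L∸c₁ : c₂ < L ∸ c₁
    c₂<L∸c₁ = m+n≤o⇒m≤o∸n (suc c₂) (≤-reflexive 1+c₂+c₁≡L)

  c₁<2+L : c₁ < suc X
  c₁<2+L = s≤s (m≤n⇒m≤1+n c₁≤L)

  c₂<2+L : c₂ < suc X
  c₂<2+L = s≤s (m≤n⇒m≤1+n c₂≤L)

  hub₁ hub₂ hubX : Fin (suc X)
  hub₁ = fromℕ< c₁<2+L
  hub₂ = fromℕ< c₂<2+L
  hubX = fromℕ< ≤-refl

  meets : Sub (suc X) → Bool
  meets S = lookup (vs S) hub₁ ∨ lookup (vs S) hub₂ ∨ lookup (vs S) hubX

  σ-fromℕ< : ∀ {i j} (i< : i < suc X) (j< : j < suc X) → swap i ≡ j → σ (fromℕ< i<) ≡ fromℕ< j<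
  σ-fromℕ< i< j< swap-i≡j = toℕ-injective
    (trans (toℕ-σ (fromℕ< i<)) (trans (cong swap (toℕ-fromℕ< i<)) (trans swap-i≡j (sym (toℕ-fromℕ< j<)))))

  σ-hub₁ : σ hub₁ ≡ hub₂
  σ-hub₁ = σ-fromℕ< c₁<2+L c₂<2+L swap-c₁

  σ-hub₂ : σ hub₂ ≡ hub₁
  σ-hub₂ = trans (cong σ (sym σ-hub₁)) (σ-involutive hub₁)

  σ-hubX : σ hubX ≡ hubX
  σ-hubX = σ-fromℕ< ≤-refl ≤-refl (swap-fixed (m≤n+m _ 2))

  meets-relabel : ∀ S → meets (relabel S) ≡ meets S
  meets-relabel S = begin
    meets (relabel S)  ≡⟨ cong₂ _∨_ (at σ-hub₁) (cong₂ _∨_ (at σ-hub₂) (at σ-hubX)) ⟩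
    b ∨ (a ∨ x)        ≡⟨ x∙yz≈y∙xz b a x ⟩
    meets S            ∎
    where
    open ≡-Reasoning
    a b x : Bool
    a = lookup (vs S) hub₁
    b = lookup (vs S) hub₂
    x = lookup (vs S) hubX
    at : ∀ {v w} → σ v ≡ w → lookup (vs (relabel S)) v ≡ lookup (vs S) w
    at {v} σv≡w = trans (lookup-relabel S v) (cong (lookup (vs S)) σv≡w)

  Far : Fin (suc X) → Set
  Far v = toℕ v ≢ X × toℕ v ≢ c₁ × toℕ v ≢ c₂

  ¬meets⇒far : ∀ S → meets S ≡ false → ∀ v → SVert S v → Far v
  ¬meets⇒far S off v v∈S =
    absent ≤-refl (∨-conicalʳ b x b∨x-off) ,
    absent c₁<2+L (∨-conicalˡ a (b ∨ x) off) ,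
    absent c₂<2+L (∨-conicalˡ b x b∨x-off)
    where
    a b x : Bool
    a = lookup (vs S) hub₁
    b = lookup (vs S) hub₂
    x = lookup (vs S) hubX
    b∨x-off : b ∨ x ≡ false
    b∨x-off = ∨-conicalʳ a (b ∨ x) off
    absent : ∀ {w} (w< : w < suc X) → lookup (vs S) (fromℕ< w<) ≡ false → toℕ v ≢ w
    absent w< w-off v≡w = contradiction
      (trans (sym (Equivalence.to ∈⇔lookup v∈S))
             (trans (cong (lookup (vs S)) (toℕ-injective (trans v≡w (sym (toℕ-fromℕ< w<))))) w-off))
      λ ()

  meets-hub : ∀ S → meets S ≡ true → ∃ λ w → SVert S w × (toℕ w ≡ c₁ ⊎ toℕ w ≡ c₂ ⊎ toℕ w ≡ X)
  meets-hub S on with lookup (vs S) hub₁ in e₁ | lookup (vs S) hub₂ in e₂ | lookup (vs S) hubX in e₃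
  ... | true  | _     | _    = hub₁ , Equivalence.from ∈⇔lookup e₁ , inj₁ (toℕ-fromℕ< c₁<2+L)
  ... | false | true  | _    = hub₂ , Equivalence.from ∈⇔lookup e₂ , inj₂ (inj₁ (toℕ-fromℕ< c₂<2+L))
  ... | false | false | true = hubX , Equivalence.from ∈⇔lookup e₃ , inj₂ (inj₂ (toℕ-fromℕ< {n = suc X} ≤-refl))

  module _ {c} (c≤L : c ≤ L) (c-hub : c ≡ c₁ ⊎ c ≡ c₂) {k} {D : Graph k} {a : Fin k → ℕ} (k≤m : k ≤ m) where

    -- A subtree with at most m vertices through a hub stays within distance m of c₁ or c₂.
    meets⇒near : ∀ S → IsDegreeImage D a (pendantPath c c≤L) S → meets S ≡ true →
                 ∀ v → SVert S v → Near (toℕ v)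
    meets⇒near S (((_ , E⊆T , E-ends) , _ , conn , _) , φ , _ , φ-onto , _) on v v∈S
      with w , w∈S , w-hub ← meets-hub S on
      with path-or-X (toℕ<n v)
    ... | inj₂ v≡X = subst Near (sym v≡X) near-X
    ... | inj₁ v≤L = near-window (hub-pos w-hub)
      (≤-trans (subst (_< pos′ w + k) (ifX-path v≤L) (spread w∈S v∈S)) (+-monoʳ-≤ (pos′ w) k≤m))
      (≤-trans (subst (λ i → pos′ w < i + k) (ifX-path v≤L) (spread v∈S w∈S)) (+-monoʳ-≤ (toℕ v) k≤m))
      where
      pos′ : Fin (suc X) → ℕ
      pos′ = pos c≤L ∘ toℕ
      spread : ∀ {y z} → SVert S y → SVert S z → pos′ z < pos′ y + k
      spread = spread-bound (SVert S) (SEdge S) pos′ (λ {u} {v} e → proj₂ (E-ends u v e))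
        (λ {u} {v} e → pos-step c≤L (Equivalence.to (adj⇔link c≤L u v) (E⊆T u v e)))
        conn φ (λ u → Equivalence.to (φ-onto u))
      hub-pos : ∀ {w} → toℕ w ≡ c₁ ⊎ toℕ w ≡ c₂ ⊎ toℕ w ≡ X → pos′ w ≡ c₁ ⊎ pos′ w ≡ c₂
      hub-pos (inj₁ w≡c₁)        = inj₁ (trans (cong (pos c≤L) w≡c₁) (ifX-path c₁≤L))
      hub-pos (inj₂ (inj₁ w≡c₂)) = inj₂ (trans (cong (pos c≤L) w≡c₂) (ifX-path c₂≤L))
      hub-pos (inj₂ (inj₂ w≡X))  = subst (λ i → i ≡ c₁ ⊎ i ≡ c₂) (sym (trans (cong (pos c≤L) w≡X) ifX-X)) c-hub

  same-degreeEmbeddingNumber : ∀ {k} (D : Graph k) a → k ≤ m → SameDegreeEmbeddingNumber D a T₁ T₂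
  same-degreeEmbeddingNumber D a k≤m = sameDegreeEmbeddingNumber-bySwap {D = D} {a} {T₁} {T₂}
    (σ-agrees c₁≤L c₂≤L swap-c₁) (far-agrees c₁≤L c₂≤L)
    (meets⇒near c₁≤L (inj₁ refl) {D = D} {a} k≤m) (meets⇒near c₂≤L (inj₂ refl) {D = D} {a} k≤m) ¬meets⇒far
    where
    open SwapCriterion σ σ-involutive meets meets-relabel (Near ∘ toℕ) Far
           (λ {u} near-u → subst Near (sym (toℕ-σ u)) (Near-swap near-u))

proposition3p3 : (m : ℕ) → 1 ≤ m →
    Σ ℕ λ n₁ → Σ ℕ λ n₂ → Σ (Graph n₁) λ T₁ → Σ (Graph n₂) λ T₂ →
      IsTree T₁ × IsTree T₂ × ¬ Iso T₁ T₂ ×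
      ((k : ℕ) → k ≤ m → (D : Graph k) → IsTree D →
        (a : Fin k → ℕ) → (∀ u → 1 ≤ a u) →
        SameDegreeEmbeddingNumber D a T₁ T₂)
proposition3p3 m _ =
  suc X , suc X , T₁ , T₂ , pendantPath-isTree c₁≤L , pendantPath-isTree c₂≤L , T₁≇T₂ ,
  λ k k≤m D _ a _ → same-degreeEmbeddingNumber D a k≤m
  where open Construction m
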